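{- Let $E_n$ be the Euler numbers, defined by $\sum_{n\ge0}E_n\frac{t^n}{n!}=\frac{2}{e^t+e^{ -t}}$. Let $T(n,k)$ be the central factorial numbers of the second kind, defined by $(e^{x/2}-e^{ -x/2})^k=k!\sum_{n\ge k}T(n,k)\frac{x^n}{n!}$ (so $T(0,0)=1$). Let $\Delta(x,k)$ be the polynomials defined by $\Delta(x,0)=1$ and $$\Delta(x,k+1)=(x+1)(2x+1)\Delta(x+1,k)-x^2\Delta(x,k)\quad(k\ge0).$$ Then for all non-negative integers $n$ and $k$, $$E_{2n+2k}=\sum_{j=0}^n\frac{(-1)^{j-k}(2j)!\,\Delta(j,k)}{2^j}\,T(2n,2j).$$ -}

module Defs where

open import Data.Nat using (ℕ; zero; suc; _!)
import Data.Nat as ℕ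
open import Data.Nat.Combinatorics using (_C_)
open import Data.Integer using (+_)
open import Data.Rational using (ℚ; 0ℚ; 1ℚ; ½; _+_; _*_; -_; _-_; _/_)
open import Relation.Binary.PropositionalEquality using (_≡_)

ι : ℕ → ℚ
ι n = (+ n) / 1

_^ℚ_ : ℚ → ℕ → ℚ
x ^ℚ zero = 1ℚ
x ^ℚ suc n = x * (x ^ℚ n)

sumTo : ℕ → (ℕ → ℚ) → ℚ
sumTo zero f = f 0
sumTo (suc n) f = sumTo n f + f (suc n)

-- Exponential generating functions: a : ℕ → ℚ represents Σ a n · tⁿ/n!.
EGF : Set
EGF = ℕ → ℚ

-- product of EGFs (binomial convolution)
_⋆_ : EGF → EGF → EGF
(a ⋆ b) n = sumTo n (λ i → ι (n C i) * (a i * b (n ℕ.∸ i)))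

_⊕_ : EGF → EGF → EGF
(a ⊕ b) n = a n + b n

_⊖_ : EGF → EGF → EGF
(a ⊖ b) n = a n - b n

const : ℚ → EGF
const c zero = c
const c (suc _) = 0ℚ

expS : ℚ → EGF
expS c n = c ^ℚ n

_^S_ : EGF → ℕ → EGF
a ^S zero = const 1ℚ
a ^S suc k = a ⋆ (a ^S k)

-- E is the sequence of Euler numbers:  Σ E n tⁿ/n! = 2/(e^t + e^{-t}),
-- i.e. (Σ E n tⁿ/n!) · (e^t + e^{-t}) = 2 as formal power series.
IsEuler : (ℕ → ℚ) → Set
IsEuler E = ∀ n → (E ⋆ (expS 1ℚ ⊕ expS (- 1ℚ))) n ≡ const (ι 2) n

IsCentralFact2 : (ℕ → ℕ → ℚ) → Set
IsCentralFact2 T = ∀ n k → k ℕ.≤ n →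
  ((expS ½ ⊖ expS (- ½)) ^S k) n ≡ ι (k !) * T n k

Δ : ℕ → ℚ → ℚ
Δ zero x = 1ℚ
Δ (suc k) x = ((x + 1ℚ) * ((ι 2 * x) + 1ℚ)) * Δ k (x + 1ℚ) - (x * x) * Δ k x

-- Write sh = e^{t/2} - e^{-t/2}.  By definition (2j)! T(2n,2j) is the coefficient of
-- t^{2n}/(2n)! in sh^{2j}, and since e^t + e^{-t} = 2 + sh², the Euler series is
-- 1 / (1 + sh²/2) = Σ_j (-1/2)^j sh^{2j}: this is the case k = 0.  Differentiating twice
-- gives the central factorial recurrence
--   ∂² sh^{m+2} = (m+2)(m+1) sh^m + (m+2)²/4 · sh^{m+2},
-- which turns the sum for (n+1, k) into the sum for (n, k+1) precisely because the
-- weights (-1)^{j+k} 2^{-j} Δ(j,k) obey the recurrence defining Δ(x,k+1).  Iterating k times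
-- reduces everything to k = 0.
module Submission where

open import Defs

module EulerSeries where
  open import Level using (0ℓ)
  open import Function using (_∘_)
  open import Data.Nat as ℕ using (ℕ; zero; suc; _!; _≤_; _<_; z≤n; s≤s; _∸_)
  import Data.Nat.Properties as ℕ
  open import Data.Nat.Combinatorics using (_C_; nCk+nC[k+1]≡[n+1]C[k+1])
  open import Data.Nat.Combinatorics.Specification using (k>n⇒nCk≡0)
  import Data.Nat.Coprimality as Coprime
  import Data.Integer as ℤ
  import Data.Integer.Properties as ℤ
  open import Data.Rational using (ℚ; 0ℚ; 1ℚ; ½; _+_; _*_; -_; _-_; _/_; mkℚ)
  open import Data.Rational.Properties
    using ( +-*-commutativeRing; +-0-commutativeMonoid; _≟_; normalize-coprime
          ; +-assoc; +-comm; +-identityˡ; +-identityʳ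
          ; *-assoc; *-comm; *-identityˡ; *-zeroˡ; *-zeroʳ; *-distribˡ-+; *-distribʳ-+ )
  open import Algebra.Bundles using (CommutativeMonoid)
  open import Algebra.Properties.CommutativeSemigroup
    (CommutativeMonoid.commutativeSemigroup +-0-commutativeMonoid)
    using () renaming (interchange to +-interchange; x∙yz≈y∙xz to x+[y+z]≡y+[x+z])
  open import Relation.Nullary.Decidable using (dec⇒maybe)
  open import Relation.Binary.PropositionalEquality
  open import Tactic.RingSolver using (solve-∀)
  open import Tactic.RingSolver.Core.AlmostCommutativeRing using (AlmostCommutativeRing; fromCommutativeRing)

  ℚ-ring : AlmostCommutativeRing 0ℓ 0ℓ
  ℚ-ring = fromCommutativeRing +-*-commutativeRing (λ x → dec⇒maybe (0ℚ ≟ x))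

  ι≡mkℚ : ∀ n → ι n ≡ mkℚ (ℤ.+ n) 0 (Coprime.sym (Coprime.1-coprimeTo n))
  ι≡mkℚ n = normalize-coprime (Coprime.sym (Coprime.1-coprimeTo n))

  ι-+ : ∀ m n → ι (m ℕ.+ n) ≡ ι m + ι n
  ι-+ m n = begin
    (ℤ.+ (m ℕ.+ n)) / 1                          ≡⟨ cong (_/ 1) (ℤ.pos-+ m n) ⟩
    (ℤ.+ m ℤ.+ ℤ.+ n) / 1                        ≡⟨ cong₂ (λ x y → (x ℤ.+ y) / 1) (ℤ.*-identityʳ (ℤ.+ m)) (ℤ.*-identityʳ (ℤ.+ n)) ⟨
    (ℤ.+ m ℤ.* ℤ.+ 1 ℤ.+ ℤ.+ n ℤ.* ℤ.+ 1) / 1    ≡⟨ cong₂ _+_ (ι≡mkℚ m) (ι≡mkℚ n) ⟨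
    ι m + ι n                                    ∎
    where open ≡-Reasoning

  ι-* : ∀ m n → ι (m ℕ.* n) ≡ ι m * ι n
  ι-* m n = trans (cong (_/ 1) (ℤ.pos-* m n)) (sym (cong₂ _*_ (ι≡mkℚ m) (ι≡mkℚ n)))

  ι-suc : ∀ n → ι (suc n) ≡ ι n + 1ℚ
  ι-suc n = trans (cong ι (ℕ.+-comm 1 n)) (ι-+ n 1)

  sumTo-cong : ∀ n {f g : ℕ → ℚ} → (∀ i → i ≤ n → f i ≡ g i) → sumTo n f ≡ sumTo n g
  sumTo-cong zero    f≡g = f≡g 0 z≤n
  sumTo-cong (suc n) f≡g = cong₂ _+_ (sumTo-cong n (λ i i≤n → f≡g i (ℕ.m≤n⇒m≤1+n i≤n))) (f≡g (suc n) ℕ.≤-refl)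

  sumTo-zero : ∀ n {f : ℕ → ℚ} → (∀ i → i ≤ n → f i ≡ 0ℚ) → sumTo n f ≡ 0ℚ
  sumTo-zero zero    f≡0 = f≡0 0 z≤n
  sumTo-zero (suc n) f≡0 = cong₂ _+_ (sumTo-zero n (λ i i≤n → f≡0 i (ℕ.m≤n⇒m≤1+n i≤n))) (f≡0 (suc n) ℕ.≤-refl)

  sumTo-+ : ∀ n (f g : ℕ → ℚ) → sumTo n (λ i → f i + g i) ≡ sumTo n f + sumTo n g
  sumTo-+ zero    f g = refl
  sumTo-+ (suc n) f g = trans (cong (_+ (f (suc n) + g (suc n))) (sumTo-+ n f g)) (+-interchange (sumTo n f) (sumTo n g) (f (suc n)) (g (suc n)))

  sumTo-*ˡ : ∀ n q (f : ℕ → ℚ) → sumTo n (λ i → q * f i) ≡ q * sumTo n f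
  sumTo-*ˡ zero    q f = refl
  sumTo-*ˡ (suc n) q f = trans (cong (_+ q * f (suc n)) (sumTo-*ˡ n q f)) (sym (*-distribˡ-+ q _ _))

  sumTo-suc : ∀ n (f : ℕ → ℚ) → sumTo (suc n) f ≡ f 0 + sumTo n (f ∘ suc)
  sumTo-suc zero    f = refl
  sumTo-suc (suc n) f = trans (cong (_+ f (2 ℕ.+ n)) (sumTo-suc n f)) (+-assoc (f 0) _ _)

  sumTo-shift : ∀ n (f : ℕ → ℚ) → f 0 ≡ 0ℚ → f (suc n) ≡ 0ℚ → sumTo n (f ∘ suc) ≡ sumTo n f
  sumTo-shift n f f0≡0 f[1+n]≡0 = begin
    sumTo n (f ∘ suc)          ≡⟨ +-identityˡ _ ⟨
    0ℚ + sumTo n (f ∘ suc)     ≡⟨ cong (_+ sumTo n (f ∘ suc)) f0≡0 ⟨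
    f 0 + sumTo n (f ∘ suc)    ≡⟨ sumTo-suc n f ⟨
    sumTo n f + f (suc n)      ≡⟨ cong (sumTo n f +_) f[1+n]≡0 ⟩
    sumTo n f + 0ℚ             ≡⟨ +-identityʳ _ ⟩
    sumTo n f                  ∎
    where open ≡-Reasoning

  _·_ : ℚ → EGF → EGF
  (q · a) n = q * a n

  ∂ : EGF → EGF
  ∂ a n = a (suc n)

  _VanishesBelow_ : EGF → ℕ → Set
  a VanishesBelow m = ∀ n → n < m → a n ≡ 0ℚ

  ⋆-at-0 : ∀ a b → (a ⋆ b) 0 ≡ a 0 * b 0
  ⋆-at-0 a b = *-identityˡ (a 0 * b 0)

  ⋆-congˡ-≤ : ∀ n {a a′} b → (∀ i → i ≤ n → a i ≡ a′ i) → (a ⋆ b) n ≡ (a′ ⋆ b) n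
  ⋆-congˡ-≤ n b a≡a′ = sumTo-cong n (λ i i≤n → cong (λ x → ι (n C i) * (x * b (n ∸ i))) (a≡a′ i i≤n))

  ⋆-congˡ : ∀ {a a′} b → a ≗ a′ → a ⋆ b ≗ a′ ⋆ b
  ⋆-congˡ b a≗a′ n = ⋆-congˡ-≤ n b (λ i _ → a≗a′ i)

  ⋆-congʳ : ∀ a {b b′} → b ≗ b′ → a ⋆ b ≗ a ⋆ b′
  ⋆-congʳ a b≗b′ n = sumTo-cong n (λ i _ → cong (λ y → ι (n C i) * (a i * y)) (b≗b′ (n ∸ i)))

  ⋆-vanishesBelowˡ : ∀ {a m} b → a VanishesBelow m → (a ⋆ b) VanishesBelow m
  ⋆-vanishesBelowˡ {a} b a≡0 n n<m = sumTo-zero n λ i i≤n → begin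
    ι (n C i) * (a i * b (n ∸ i))   ≡⟨ cong (λ x → ι (n C i) * (x * b (n ∸ i))) (a≡0 i (ℕ.≤-<-trans i≤n n<m)) ⟩
    ι (n C i) * (0ℚ * b (n ∸ i))    ≡⟨ cong (ι (n C i) *_) (*-zeroˡ (b (n ∸ i))) ⟩
    ι (n C i) * 0ℚ                  ≡⟨ *-zeroʳ (ι (n C i)) ⟩
    0ℚ                              ∎
    where open ≡-Reasoning

  -- Pascal's rule C(n+1, i+1) = C(n, i) + C(n, i+1) splits each term of the product.
  ∂-⋆ : ∀ a b → ∂ (a ⋆ b) ≗ (∂ a ⋆ b) ⊕ (a ⋆ ∂ b)
  ∂-⋆ a b n = begin
    sumTo (suc n) term                                      ≡⟨ sumTo-suc n term ⟩
    term 0 + sumTo n (term ∘ suc)                           ≡⟨ cong (term 0 +_) (trans (sumTo-cong n (λ i _ → pascal i)) (sumTo-+ n left (right ∘ suc))) ⟩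
    term 0 + (sumTo n left + sumTo n (right ∘ suc))         ≡⟨ x+[y+z]≡y+[x+z] (term 0) (sumTo n left) (sumTo n (right ∘ suc)) ⟩
    sumTo n left + (right 0 + sumTo n (right ∘ suc))        ≡⟨ cong (sumTo n left +_) (sumTo-suc n right) ⟨
    sumTo n left + (sumTo n right + right (suc n))          ≡⟨ cong (λ x → sumTo n left + (sumTo n right + x)) right[1+n]≡0 ⟩
    sumTo n left + (sumTo n right + 0ℚ)                     ≡⟨ cong (sumTo n left +_) (+-identityʳ (sumTo n right)) ⟩
    sumTo n left + sumTo n right                            ≡⟨ cong (sumTo n left +_) (sumTo-cong n (λ i i≤n → cong (λ m → ι (n C i) * (a i * b m)) (ℕ.+-∸-assoc 1 i≤n))) ⟩
    (∂ a ⋆ b) n + (a ⋆ ∂ b) n                               ∎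
    where
    open ≡-Reasoning
    term left right : ℕ → ℚ
    term  i = ι (suc n C i) * (a i * b (suc n ∸ i))
    left  i = ι (n C i) * (a (suc i) * b (n ∸ i))
    right i = ι (n C i) * (a i * b (suc n ∸ i))
    pascal : ∀ i → term (suc i) ≡ left i + right (suc i)
    pascal i = begin
      ι (suc n C suc i) * (a (suc i) * b (n ∸ i))              ≡⟨ cong (λ m → ι m * (a (suc i) * b (n ∸ i))) (nCk+nC[k+1]≡[n+1]C[k+1] n i) ⟨
      ι (n C i ℕ.+ n C suc i) * (a (suc i) * b (n ∸ i))        ≡⟨ cong (_* (a (suc i) * b (n ∸ i))) (ι-+ (n C i) (n C suc i)) ⟩
      (ι (n C i) + ι (n C suc i)) * (a (suc i) * b (n ∸ i))    ≡⟨ *-distribʳ-+ (a (suc i) * b (n ∸ i)) (ι (n C i)) (ι (n C suc i)) ⟩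
      left i + right (suc i)                                   ∎
    right[1+n]≡0 : right (suc n) ≡ 0ℚ
    right[1+n]≡0 = begin
      ι (n C suc n) * (a (suc n) * b (n ∸ n))    ≡⟨ cong (λ m → ι m * (a (suc n) * b (n ∸ n))) (k>n⇒nCk≡0 (ℕ.n<1+n n)) ⟩
      0ℚ * (a (suc n) * b (n ∸ n))               ≡⟨ *-zeroˡ (a (suc n) * b (n ∸ n)) ⟩
      0ℚ                                         ∎

  ⋆-distribʳ-⊕ : ∀ a b c → (a ⊕ b) ⋆ c ≗ (a ⋆ c) ⊕ (b ⋆ c)
  ⋆-distribʳ-⊕ a b c n =
    trans (sumTo-cong n (λ i _ → distrib (ι (n C i)) (a i) (b i) (c (n ∸ i)))) (sumTo-+ n _ _)
    where
    distrib : ∀ k x y z → k * ((x + y) * z) ≡ k * (x * z) + k * (y * z)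
    distrib = solve-∀ ℚ-ring

  ⋆-distribˡ-⊕ : ∀ a b c → a ⋆ (b ⊕ c) ≗ (a ⋆ b) ⊕ (a ⋆ c)
  ⋆-distribˡ-⊕ a b c n =
    trans (sumTo-cong n (λ i _ → distrib (ι (n C i)) (a i) (b (n ∸ i)) (c (n ∸ i)))) (sumTo-+ n _ _)
    where
    distrib : ∀ k x y z → k * (x * (y + z)) ≡ k * (x * y) + k * (x * z)
    distrib = solve-∀ ℚ-ring

  ·-⋆ : ∀ q a b → (q · a) ⋆ b ≗ q · (a ⋆ b)
  ·-⋆ q a b n = trans (sumTo-cong n (λ i _ → pull q (ι (n C i)) (a i) (b (n ∸ i)))) (sumTo-*ˡ n q _)
    where
    pull : ∀ q k x y → k * ((q * x) * y) ≡ q * (k * (x * y))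
    pull = solve-∀ ℚ-ring

  ⋆-· : ∀ q a b → a ⋆ (q · b) ≗ q · (a ⋆ b)
  ⋆-· q a b n = trans (sumTo-cong n (λ i _ → pull q (ι (n C i)) (a i) (b (n ∸ i)))) (sumTo-*ˡ n q _)
    where
    pull : ∀ q k x y → k * (x * (q * y)) ≡ q * (k * (x * y))
    pull = solve-∀ ℚ-ring

  ⋆-comm : ∀ a b → a ⋆ b ≗ b ⋆ a
  ⋆-comm a b zero    = trans (⋆-at-0 a b) (trans (*-comm (a 0) (b 0)) (sym (⋆-at-0 b a)))
  ⋆-comm a b (suc n) = begin
    (a ⋆ b) (suc n)               ≡⟨ ∂-⋆ a b n ⟩
    (∂ a ⋆ b) n + (a ⋆ ∂ b) n     ≡⟨ cong₂ _+_ (⋆-comm (∂ a) b n) (⋆-comm a (∂ b) n) ⟩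
    (b ⋆ ∂ a) n + (∂ b ⋆ a) n     ≡⟨ +-comm ((b ⋆ ∂ a) n) ((∂ b ⋆ a) n) ⟩
    (∂ b ⋆ a) n + (b ⋆ ∂ a) n     ≡⟨ ∂-⋆ b a n ⟨
    (b ⋆ a) (suc n)               ∎
    where open ≡-Reasoning

  ⋆-assoc : ∀ a b c → (a ⋆ b) ⋆ c ≗ a ⋆ (b ⋆ c)
  ⋆-assoc a b c zero = begin
    ((a ⋆ b) ⋆ c) 0        ≡⟨ trans (⋆-at-0 (a ⋆ b) c) (cong (_* c 0) (⋆-at-0 a b)) ⟩
    (a 0 * b 0) * c 0      ≡⟨ *-assoc (a 0) (b 0) (c 0) ⟩
    a 0 * (b 0 * c 0)      ≡⟨ trans (⋆-at-0 a (b ⋆ c)) (cong (a 0 *_) (⋆-at-0 b c)) ⟨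
    (a ⋆ (b ⋆ c)) 0        ∎
    where open ≡-Reasoning
  ⋆-assoc a b c (suc n) = begin
    ((a ⋆ b) ⋆ c) (suc n)
      ≡⟨ ∂-⋆ (a ⋆ b) c n ⟩
    (∂ (a ⋆ b) ⋆ c) n + ((a ⋆ b) ⋆ ∂ c) n
      ≡⟨ cong (_+ ((a ⋆ b) ⋆ ∂ c) n) (trans (⋆-congˡ c (∂-⋆ a b) n) (⋆-distribʳ-⊕ (∂ a ⋆ b) (a ⋆ ∂ b) c n)) ⟩
    (((∂ a ⋆ b) ⋆ c) n + ((a ⋆ ∂ b) ⋆ c) n) + ((a ⋆ b) ⋆ ∂ c) n
      ≡⟨ cong₂ _+_ (cong₂ _+_ (⋆-assoc (∂ a) b c n) (⋆-assoc a (∂ b) c n)) (⋆-assoc a b (∂ c) n) ⟩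
    ((∂ a ⋆ (b ⋆ c)) n + (a ⋆ (∂ b ⋆ c)) n) + (a ⋆ (b ⋆ ∂ c)) n
      ≡⟨ +-assoc ((∂ a ⋆ (b ⋆ c)) n) ((a ⋆ (∂ b ⋆ c)) n) ((a ⋆ (b ⋆ ∂ c)) n) ⟩
    (∂ a ⋆ (b ⋆ c)) n + ((a ⋆ (∂ b ⋆ c)) n + (a ⋆ (b ⋆ ∂ c)) n)
      ≡⟨ cong ((∂ a ⋆ (b ⋆ c)) n +_) (trans (⋆-congʳ a (∂-⋆ b c) n) (⋆-distribˡ-⊕ a (∂ b ⋆ c) (b ⋆ ∂ c) n)) ⟨
    (∂ a ⋆ (b ⋆ c)) n + (a ⋆ ∂ (b ⋆ c)) n
      ≡⟨ ∂-⋆ a (b ⋆ c) n ⟨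
    (a ⋆ (b ⋆ c)) (suc n)
      ∎
    where open ≡-Reasoning

  const-⋆ : ∀ q a → const q ⋆ a ≗ q · a
  const-⋆ q a zero    = ⋆-at-0 (const q) a
  const-⋆ q a (suc n) = begin
    (const q ⋆ a) (suc n)                            ≡⟨ ∂-⋆ (const q) a n ⟩
    (∂ (const q) ⋆ a) n + (const q ⋆ ∂ a) n          ≡⟨ cong₂ _+_ (⋆-vanishesBelowˡ a (λ _ _ → refl) n (ℕ.n<1+n n)) (const-⋆ q (∂ a) n) ⟩
    0ℚ + q * a (suc n)                               ≡⟨ +-identityˡ (q * a (suc n)) ⟩
    q * a (suc n)                                    ∎
    where open ≡-Reasoning

  ⋆-const : ∀ q a → a ⋆ const q ≗ q · a
  ⋆-const q a n = trans (⋆-comm a (const q) n) (const-⋆ q a n)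

  ⋆-vanishesBelowʳ : ∀ {b m} a → b VanishesBelow m → (a ⋆ b) VanishesBelow m
  ⋆-vanishesBelowʳ {b} a b≡0 n n<m = trans (⋆-comm a b n) (⋆-vanishesBelowˡ a b≡0 n n<m)

  ⋆-leftComm : ∀ a b c → a ⋆ (b ⋆ c) ≗ b ⋆ (a ⋆ c)
  ⋆-leftComm a b c n = begin
    (a ⋆ (b ⋆ c)) n     ≡⟨ ⋆-assoc a b c n ⟨
    ((a ⋆ b) ⋆ c) n     ≡⟨ ⋆-congˡ c (⋆-comm a b) n ⟩
    ((b ⋆ a) ⋆ c) n     ≡⟨ ⋆-assoc b a c n ⟩
    (b ⋆ (a ⋆ c)) n     ∎
    where open ≡-Reasoning

  ^S-+ : ∀ a m n → (a ^S m) ⋆ (a ^S n) ≗ a ^S (m ℕ.+ n)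
  ^S-+ a zero    n i = trans (const-⋆ 1ℚ (a ^S n) i) (*-identityˡ ((a ^S n) i))
  ^S-+ a (suc m) n i = trans (⋆-assoc a (a ^S m) (a ^S n) i) (⋆-congʳ a (^S-+ a m n) i)

  ¼ : ℚ
  ¼ = ½ * ½

  sh ch : EGF
  sh = expS ½ ⊖ expS (- ½)
  ch = ½ · (expS ½ ⊕ expS (- ½))

  ∂-sh : ∂ sh ≗ ch
  ∂-sh n = lemma (½ ^ℚ n) ((- ½) ^ℚ n)
    where
    lemma : ∀ x y → ½ * x - (- ½) * y ≡ ½ * (x + y)
    lemma = solve-∀ ℚ-ring

  ∂-ch : ∂ ch ≗ ¼ · sh
  ∂-ch n = lemma (½ ^ℚ n) ((- ½) ^ℚ n)
    where
    lemma : ∀ x y → ½ * (½ * x + (- ½) * y) ≡ ¼ * (x - y)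
    lemma = solve-∀ ℚ-ring

  ch⋆ch : ch ⋆ ch ≗ const 1ℚ ⊕ (¼ · (sh ⋆ sh))
  ch⋆ch zero    = refl
  ch⋆ch (suc n) = begin
    (ch ⋆ ch) (suc n)                      ≡⟨ ∂-⋆ ch ch n ⟩
    (∂ ch ⋆ ch) n + (ch ⋆ ∂ ch) n          ≡⟨ cong₂ _+_ (trans (⋆-congˡ ch ∂-ch n) (·-⋆ ¼ sh ch n)) (trans (⋆-congʳ ch ∂-ch n) (⋆-· ¼ ch sh n)) ⟩
    ¼ * (sh ⋆ ch) n + ¼ * (ch ⋆ sh) n      ≡⟨ lemma ((sh ⋆ ch) n) ((ch ⋆ sh) n) ⟩
    0ℚ + ¼ * ((ch ⋆ sh) n + (sh ⋆ ch) n)   ≡⟨ cong (λ x → 0ℚ + ¼ * x) (cong₂ _+_ (⋆-congˡ sh ∂-sh n) (⋆-congʳ sh ∂-sh n)) ⟨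
    0ℚ + ¼ * ((∂ sh ⋆ sh) ⊕ (sh ⋆ ∂ sh)) n ≡⟨ cong (λ x → 0ℚ + ¼ * x) (∂-⋆ sh sh n) ⟨
    0ℚ + ¼ * (sh ⋆ sh) (suc n)             ∎
    where
    open ≡-Reasoning
    lemma : ∀ x y → ¼ * x + ¼ * y ≡ 0ℚ + ¼ * (y + x)
    lemma = solve-∀ ℚ-ring

  ∂-sh^ : ∀ k → ∂ (sh ^S suc k) ≗ ι (suc k) · (ch ⋆ (sh ^S k))
  ∂-sh^ zero n = begin
    (sh ⋆ const 1ℚ) (suc n)                               ≡⟨ ∂-⋆ sh (const 1ℚ) n ⟩
    (∂ sh ⋆ const 1ℚ) n + (sh ⋆ ∂ (const 1ℚ)) n           ≡⟨ cong₂ _+_ (⋆-congˡ (const 1ℚ) ∂-sh n) (⋆-vanishesBelowʳ sh (λ _ _ → refl) n (ℕ.n<1+n n)) ⟩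
    (ch ⋆ const 1ℚ) n + 0ℚ                                ≡⟨ +-identityʳ _ ⟩
    (ch ⋆ const 1ℚ) n                                     ≡⟨ *-identityˡ _ ⟨
    ι 1 * (ch ⋆ const 1ℚ) n                               ∎
    where open ≡-Reasoning
  ∂-sh^ (suc k) n = begin
    (sh ⋆ (sh ^S suc k)) (suc n)
      ≡⟨ ∂-⋆ sh (sh ^S suc k) n ⟩
    (∂ sh ⋆ (sh ^S suc k)) n + (sh ⋆ ∂ (sh ^S suc k)) n
      ≡⟨ cong₂ _+_ (⋆-congˡ (sh ^S suc k) ∂-sh n) (trans (⋆-congʳ sh (∂-sh^ k) n) (⋆-· (ι (suc k)) sh (ch ⋆ (sh ^S k)) n)) ⟩
    (ch ⋆ (sh ^S suc k)) n + ι (suc k) * (sh ⋆ (ch ⋆ (sh ^S k))) n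
      ≡⟨ cong (λ x → (ch ⋆ (sh ^S suc k)) n + ι (suc k) * x) (⋆-leftComm sh ch (sh ^S k) n) ⟩
    (ch ⋆ (sh ^S suc k)) n + ι (suc k) * (ch ⋆ (sh ^S suc k)) n
      ≡⟨ lemma (ι (suc k)) ((ch ⋆ (sh ^S suc k)) n) ⟩
    (1ℚ + ι (suc k)) * (ch ⋆ (sh ^S suc k)) n
      ≡⟨ cong (_* (ch ⋆ (sh ^S suc k)) n) (ι-+ 1 (suc k)) ⟨
    ι (2 ℕ.+ k) * (ch ⋆ (sh ^S suc k)) n
      ∎
    where
    open ≡-Reasoning
    lemma : ∀ κ x → x + κ * x ≡ (1ℚ + κ) * x
    lemma = solve-∀ ℚ-ring

  sh^-vanishesBelow : ∀ k → (sh ^S k) VanishesBelow k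
  sh^-vanishesBelow (suc k) zero    _         = trans (⋆-at-0 sh (sh ^S k)) (*-zeroˡ ((sh ^S k) 0))
  sh^-vanishesBelow (suc k) (suc n) (s≤s n<k) = begin
    (sh ^S suc k) (suc n)             ≡⟨ ∂-sh^ k n ⟩
    ι (suc k) * (ch ⋆ (sh ^S k)) n    ≡⟨ cong (ι (suc k) *_) (⋆-vanishesBelowʳ ch (sh^-vanishesBelow k) n n<k) ⟩
    ι (suc k) * 0ℚ                    ≡⟨ *-zeroʳ (ι (suc k)) ⟩
    0ℚ                                ∎
    where open ≡-Reasoning

  ch⋆ch⋆ : ∀ a → ch ⋆ (ch ⋆ a) ≗ a ⊕ (¼ · (sh ⋆ (sh ⋆ a)))
  ch⋆ch⋆ a n = begin
    (ch ⋆ (ch ⋆ a)) n                                 ≡⟨ ⋆-assoc ch ch a n ⟨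
    ((ch ⋆ ch) ⋆ a) n                                 ≡⟨ ⋆-congˡ a ch⋆ch n ⟩
    ((const 1ℚ ⊕ (¼ · (sh ⋆ sh))) ⋆ a) n              ≡⟨ ⋆-distribʳ-⊕ (const 1ℚ) (¼ · (sh ⋆ sh)) a n ⟩
    (const 1ℚ ⋆ a) n + ((¼ · (sh ⋆ sh)) ⋆ a) n        ≡⟨ cong₂ _+_ (const-⋆ 1ℚ a n) (·-⋆ ¼ (sh ⋆ sh) a n) ⟩
    1ℚ * a n + ¼ * ((sh ⋆ sh) ⋆ a) n                  ≡⟨ cong₂ (λ x y → x + ¼ * y) (*-identityˡ (a n)) (⋆-assoc sh sh a n) ⟩
    a n + ¼ * (sh ⋆ (sh ⋆ a)) n                       ∎
    where open ≡-Reasoning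

  sh^-recurrence : ∀ k → ∂ (∂ (sh ^S (2 ℕ.+ k)))
    ≗ (((ι 2 + ι k) * (1ℚ + ι k)) · (sh ^S k)) ⊕ ((¼ * ((ι 2 + ι k) * (ι 2 + ι k))) · (sh ^S (2 ℕ.+ k)))
  sh^-recurrence k n = begin
    ∂ (sh ^S (2 ℕ.+ k)) (suc n)
      ≡⟨ ∂-sh^ (suc k) (suc n) ⟩
    ι (2 ℕ.+ k) * (ch ⋆ (sh ^S suc k)) (suc n)
      ≡⟨ cong (ι (2 ℕ.+ k) *_) (∂-⋆ ch (sh ^S suc k) n) ⟩
    ι (2 ℕ.+ k) * ((∂ ch ⋆ (sh ^S suc k)) n + (ch ⋆ ∂ (sh ^S suc k)) n)
      ≡⟨ cong (λ x → ι (2 ℕ.+ k) * x) (cong₂ _+_ (trans (⋆-congˡ (sh ^S suc k) ∂-ch n) (·-⋆ ¼ sh (sh ^S suc k) n))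
                                                  (trans (⋆-congʳ ch (∂-sh^ k) n) (⋆-· (ι (suc k)) ch (ch ⋆ (sh ^S k)) n))) ⟩
    ι (2 ℕ.+ k) * (¼ * (sh ^S (2 ℕ.+ k)) n + ι (suc k) * (ch ⋆ (ch ⋆ (sh ^S k))) n)
      ≡⟨ cong (λ x → ι (2 ℕ.+ k) * (¼ * (sh ^S (2 ℕ.+ k)) n + ι (suc k) * x)) (ch⋆ch⋆ (sh ^S k) n) ⟩
    ι (2 ℕ.+ k) * (¼ * (sh ^S (2 ℕ.+ k)) n + ι (suc k) * ((sh ^S k) n + ¼ * (sh ^S (2 ℕ.+ k)) n))
      ≡⟨ cong₂ (λ x y → x * (¼ * (sh ^S (2 ℕ.+ k)) n + y * ((sh ^S k) n + ¼ * (sh ^S (2 ℕ.+ k)) n))) (ι-+ 2 k) (ι-+ 1 k) ⟩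
    (ι 2 + ι k) * (¼ * (sh ^S (2 ℕ.+ k)) n + (1ℚ + ι k) * ((sh ^S k) n + ¼ * (sh ^S (2 ℕ.+ k)) n))
      ≡⟨ lemma (ι k) ((sh ^S k) n) ((sh ^S (2 ℕ.+ k)) n) ⟩
    ((ι 2 + ι k) * (1ℚ + ι k)) * (sh ^S k) n + (¼ * ((ι 2 + ι k) * (ι 2 + ι k))) * (sh ^S (2 ℕ.+ k)) n
      ∎
    where
    open ≡-Reasoning
    lemma : ∀ κ x y → (ι 2 + κ) * (¼ * y + (1ℚ + κ) * (x + ¼ * y))
                      ≡ ((ι 2 + κ) * (1ℚ + κ)) * x + (¼ * ((ι 2 + κ) * (ι 2 + κ))) * y
    lemma = solve-∀ ℚ-ring

  ∂∂≗id-unique : ∀ {a b} → ∂ (∂ a) ≗ a → ∂ (∂ b) ≗ b → a 0 ≡ b 0 → a 1 ≡ b 1 → a ≗ b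
  ∂∂≗id-unique ∂∂a≗a ∂∂b≗b a0≡b0 a1≡b1 zero          = a0≡b0
  ∂∂≗id-unique ∂∂a≗a ∂∂b≗b a0≡b0 a1≡b1 (suc zero)    = a1≡b1
  ∂∂≗id-unique ∂∂a≗a ∂∂b≗b a0≡b0 a1≡b1 (suc (suc n)) =
    trans (∂∂a≗a n) (trans (∂∂≗id-unique ∂∂a≗a ∂∂b≗b a0≡b0 a1≡b1 n) (sym (∂∂b≗b n)))

  twoCosh : EGF
  twoCosh = expS 1ℚ ⊕ expS (- 1ℚ)

  -- Both sides solve f″ = f with f(0) = 2 and f′(0) = 0.
  twoCosh≗2+sh² : twoCosh ≗ const (ι 2) ⊕ (sh ^S 2)
  twoCosh≗2+sh² = ∂∂≗id-unique ∂∂twoCosh ∂∂[2+sh²] refl refl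
    where
    ∂∂twoCosh : ∂ (∂ twoCosh) ≗ twoCosh
    ∂∂twoCosh n = lemma (1ℚ ^ℚ n) ((- 1ℚ) ^ℚ n)
      where
      lemma : ∀ x y → 1ℚ * (1ℚ * x) + (- 1ℚ) * ((- 1ℚ) * y) ≡ x + y
      lemma = solve-∀ ℚ-ring
    const2≗2·const1 : const (ι 2) ≗ ι 2 · const 1ℚ
    const2≗2·const1 zero    = refl
    const2≗2·const1 (suc _) = refl
    ∂∂[2+sh²] : ∂ (∂ (const (ι 2) ⊕ (sh ^S 2))) ≗ const (ι 2) ⊕ (sh ^S 2)
    ∂∂[2+sh²] n = begin
      0ℚ + ∂ (∂ (sh ^S 2)) n
        ≡⟨ cong (0ℚ +_) (sh^-recurrence 0 n) ⟩
      0ℚ + (((ι 2 + ι 0) * (1ℚ + ι 0)) * const 1ℚ n + (¼ * ((ι 2 + ι 0) * (ι 2 + ι 0))) * (sh ^S 2) n)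
        ≡⟨ lemma (const 1ℚ n) ((sh ^S 2) n) ⟩
      ι 2 * const 1ℚ n + (sh ^S 2) n
        ≡⟨ cong (_+ (sh ^S 2) n) (const2≗2·const1 n) ⟨
      const (ι 2) n + (sh ^S 2) n
        ∎
      where
      open ≡-Reasoning
      lemma : ∀ x y → 0ℚ + (((ι 2 + ι 0) * (1ℚ + ι 0)) * x + (¼ * ((ι 2 + ι 0) * (ι 2 + ι 0))) * y) ≡ ι 2 * x + y
      lemma = solve-∀ ℚ-ring

  coeff : ℕ → ℕ → ℚ
  coeff k j = ((- 1ℚ) ^ℚ (j ℕ.+ k) * ½ ^ℚ j) * Δ k (ι j)

  -- Partial sums of 1 / (1 + sh²/2) = 2 / (e^t + e^{-t}).
  sechApprox : ℕ → EGF
  sechApprox N i = sumTo N (λ j → coeff 0 j * (sh ^S (2 ℕ.* j)) i)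

  sechApprox-⋆-2+sh² : ∀ N → sechApprox N ⋆ (const (ι 2) ⊕ (sh ^S 2))
                             ≗ const (ι 2) ⊕ (coeff 0 N · (sh ^S (2 ℕ.* suc N)))
  sechApprox-⋆-2+sh² zero i = begin
    ((coeff 0 0 · const 1ℚ) ⋆ v) i               ≡⟨ ·-⋆ (coeff 0 0) (const 1ℚ) v i ⟩
    coeff 0 0 * (const 1ℚ ⋆ v) i                 ≡⟨ cong (coeff 0 0 *_) (trans (const-⋆ 1ℚ v i) (*-identityˡ (v i))) ⟩
    coeff 0 0 * (const (ι 2) i + (sh ^S 2) i)    ≡⟨ lemma (const (ι 2) i) ((sh ^S 2) i) ⟩
    const (ι 2) i + coeff 0 0 * (sh ^S 2) i      ∎
    where
    open ≡-Reasoning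
    v = const (ι 2) ⊕ (sh ^S 2)
    lemma : ∀ x y → coeff 0 0 * (x + y) ≡ x + coeff 0 0 * y
    lemma = solve-∀ ℚ-ring
  sechApprox-⋆-2+sh² (suc N) i = begin
    (sechApprox (suc N) ⋆ v) i
      ≡⟨ ⋆-distribʳ-⊕ (sechApprox N) (c′ · P) v i ⟩
    (sechApprox N ⋆ v) i + ((c′ · P) ⋆ v) i
      ≡⟨ cong₂ _+_ (sechApprox-⋆-2+sh² N i) (·-⋆ c′ P v i) ⟩
    (const (ι 2) i + c * P i) + c′ * (P ⋆ v) i
      ≡⟨ cong (λ x → (const (ι 2) i + c * P i) + c′ * x) (trans (⋆-distribˡ-⊕ P (const (ι 2)) (sh ^S 2) i) (cong₂ _+_ (⋆-const (ι 2) P i) P⋆sh²)) ⟩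
    (const (ι 2) i + c * P i) + c′ * (ι 2 * P i + (sh ^S (2 ℕ.* suc (suc N))) i)
      ≡⟨ lemma ((- 1ℚ) ^ℚ (N ℕ.+ 0)) (½ ^ℚ N) (const (ι 2) i) (P i) ((sh ^S (2 ℕ.* suc (suc N))) i) ⟩
    const (ι 2) i + c′ * (sh ^S (2 ℕ.* suc (suc N))) i
      ∎
    where
    open ≡-Reasoning
    v = const (ι 2) ⊕ (sh ^S 2)
    P = sh ^S (2 ℕ.* suc N)
    c = coeff 0 N
    c′ = coeff 0 (suc N)
    P⋆sh² : (P ⋆ (sh ^S 2)) i ≡ (sh ^S (2 ℕ.* suc (suc N))) i
    P⋆sh² = trans (^S-+ sh (2 ℕ.* suc N) 2 i) (cong (λ m → (sh ^S m) i) (trans (ℕ.+-comm (2 ℕ.* suc N) 2) (sym (ℕ.*-suc 2 (suc N)))))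
    -- The weights satisfy c + 2 c′ = 0, so the tail telescopes.
    lemma : ∀ g h k x y → (k + ((g * h) * 1ℚ) * x) + (((- 1ℚ * g) * (½ * h)) * 1ℚ) * (ι 2 * x + y)
                          ≡ k + (((- 1ℚ * g) * (½ * h)) * 1ℚ) * y
    lemma = solve-∀ ℚ-ring

  sechApprox-stable : ∀ {N M i} → N ≤ M → i < 2 ℕ.* suc N → sechApprox M i ≡ sechApprox N i
  sechApprox-stable {N} {i = i} N≤M i<2[1+N] = go (ℕ.≤⇒≤′ N≤M)
    where
    go : ∀ {M} → N ℕ.≤′ M → sechApprox M i ≡ sechApprox N i
    go ℕ.≤′-refl            = refl
    go (ℕ.≤′-step {M} N≤′M) = begin
      sechApprox M i + coeff 0 (suc M) * (sh ^S (2 ℕ.* suc M)) i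
        ≡⟨ cong (λ x → sechApprox M i + coeff 0 (suc M) * x) (sh^-vanishesBelow (2 ℕ.* suc M) i i<2[1+M]) ⟩
      sechApprox M i + coeff 0 (suc M) * 0ℚ
        ≡⟨ trans (cong (sechApprox M i +_) (*-zeroʳ (coeff 0 (suc M)))) (+-identityʳ (sechApprox M i)) ⟩
      sechApprox M i
        ≡⟨ go N≤′M ⟩
      sechApprox N i
        ∎
      where
      open ≡-Reasoning
      i<2[1+M] : i < 2 ℕ.* suc M
      i<2[1+M] = ℕ.<-≤-trans i<2[1+N] (ℕ.*-monoʳ-≤ 2 (s≤s (ℕ.≤′⇒≤ N≤′M)))

  sech : EGF
  sech n = sechApprox n n

  sech⋆twoCosh : sech ⋆ twoCosh ≗ const (ι 2)
  sech⋆twoCosh n = begin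
    (sech ⋆ twoCosh) n                                         ≡⟨ ⋆-congˡ-≤ n twoCosh (λ i i≤n → sym (sechApprox-stable i≤n (i<2[1+i] i))) ⟩
    (sechApprox n ⋆ twoCosh) n                                 ≡⟨ ⋆-congʳ (sechApprox n) twoCosh≗2+sh² n ⟩
    (sechApprox n ⋆ (const (ι 2) ⊕ (sh ^S 2))) n               ≡⟨ sechApprox-⋆-2+sh² n n ⟩
    const (ι 2) n + coeff 0 n * (sh ^S (2 ℕ.* suc n)) n        ≡⟨ cong (λ x → const (ι 2) n + coeff 0 n * x) (sh^-vanishesBelow (2 ℕ.* suc n) n (i<2[1+i] n)) ⟩
    const (ι 2) n + coeff 0 n * 0ℚ                             ≡⟨ trans (cong (const (ι 2) n +_) (*-zeroʳ (coeff 0 n))) (+-identityʳ (const (ι 2) n)) ⟩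
    const (ι 2) n                                              ∎
    where
    open ≡-Reasoning
    i<2[1+i] : ∀ i → i < 2 ℕ.* suc i
    i<2[1+i] i = ℕ.<-≤-trans (ℕ.n<1+n i) (ℕ.m≤n*m (suc i) 2)

  ⋆-const-unique : ∀ {a b u} q → a ⋆ u ≗ const q → b ⋆ u ≗ const q → q · a ≗ q · b
  ⋆-const-unique {a} {b} {u} q a⋆u≗q b⋆u≗q n = begin
    q * a n                 ≡⟨ ⋆-const q a n ⟨
    (a ⋆ const q) n         ≡⟨ ⋆-congʳ a b⋆u≗q n ⟨
    (a ⋆ (b ⋆ u)) n         ≡⟨ ⋆-congʳ a (⋆-comm b u) n ⟩
    (a ⋆ (u ⋆ b)) n         ≡⟨ ⋆-assoc a u b n ⟨
    ((a ⋆ u) ⋆ b) n         ≡⟨ ⋆-congˡ b a⋆u≗q n ⟩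
    (const q ⋆ b) n         ≡⟨ const-⋆ q b n ⟩
    q * b n                 ∎
    where open ≡-Reasoning

  euler≗sech : ∀ E → IsEuler E → E ≗ sech
  euler≗sech E isEuler n = begin
    E n                 ≡⟨ halve (E n) ⟩
    ½ * (ι 2 * E n)     ≡⟨ cong (½ *_) (⋆-const-unique {E} {sech} {twoCosh} (ι 2) isEuler sech⋆twoCosh n) ⟩
    ½ * (ι 2 * sech n)  ≡⟨ halve (sech n) ⟨
    sech n              ∎
    where
    open ≡-Reasoning
    halve : ∀ x → x ≡ ½ * (ι 2 * x)
    halve = solve-∀ ℚ-ring

  -- Δ's defining recurrence, moved onto the weights of the sum.
  coeff-recurrence : ∀ k j → coeff k (suc j) * ((ι 2 + ι (2 ℕ.* j)) * (1ℚ + ι (2 ℕ.* j))) + coeff k j * (ι j * ι j)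
                             ≡ coeff (suc k) j
  coeff-recurrence k j = begin
    (((- 1ℚ * g) * (½ * h)) * Δ k (ι (suc j))) * ((ι 2 + ι (2 ℕ.* j)) * (1ℚ + ι (2 ℕ.* j))) + ((g * h) * Δ k x) * (x * x)
      ≡⟨ cong₂ (λ y z → (((- 1ℚ * g) * (½ * h)) * Δ k y) * ((ι 2 + z) * (1ℚ + z)) + ((g * h) * Δ k x) * (x * x)) (ι-suc j) (ι-* 2 j) ⟩
    (((- 1ℚ * g) * (½ * h)) * Δ k (x + 1ℚ)) * ((ι 2 + ι 2 * x) * (1ℚ + ι 2 * x)) + ((g * h) * Δ k x) * (x * x)
      ≡⟨ lemma g h x (Δ k (x + 1ℚ)) (Δ k x) ⟩
    ((- 1ℚ * g) * h) * Δ (suc k) x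
      ≡⟨ cong (λ m → ((- 1ℚ) ^ℚ m * h) * Δ (suc k) x) (ℕ.+-suc j k) ⟨
    coeff (suc k) j
      ∎
    where
    open ≡-Reasoning
    g = (- 1ℚ) ^ℚ (j ℕ.+ k)
    h = ½ ^ℚ j
    x = ι j
    lemma : ∀ g h x d₁ d₀ → (((- 1ℚ * g) * (½ * h)) * d₁) * ((ι 2 + ι 2 * x) * (1ℚ + ι 2 * x)) + ((g * h) * d₀) * (x * x)
                           ≡ ((- 1ℚ * g) * h) * (((x + 1ℚ) * (ι 2 * x + 1ℚ)) * d₁ - (x * x) * d₀)
    lemma = solve-∀ ℚ-ring

  sh^-even-recurrence : ∀ j m → (sh ^S (2 ℕ.* suc j)) (2 ℕ.* suc m)
    ≡ ((ι 2 + ι (2 ℕ.* j)) * (1ℚ + ι (2 ℕ.* j))) * (sh ^S (2 ℕ.* j)) (2 ℕ.* m)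
      + (¼ * ((ι 2 + ι (2 ℕ.* j)) * (ι 2 + ι (2 ℕ.* j)))) * (sh ^S (2 ℕ.* suc j)) (2 ℕ.* m)
  sh^-even-recurrence j m = begin
    (sh ^S (2 ℕ.* suc j)) (2 ℕ.* suc m)     ≡⟨ cong₂ (λ a b → (sh ^S a) b) (ℕ.*-suc 2 j) (ℕ.*-suc 2 m) ⟩
    (sh ^S (2 ℕ.+ 2 ℕ.* j)) (2 ℕ.+ 2 ℕ.* m) ≡⟨ sh^-recurrence (2 ℕ.* j) (2 ℕ.* m) ⟩
    A * (sh ^S (2 ℕ.* j)) (2 ℕ.* m) + B * (sh ^S (2 ℕ.+ 2 ℕ.* j)) (2 ℕ.* m)
                                            ≡⟨ cong (λ a → A * (sh ^S (2 ℕ.* j)) (2 ℕ.* m) + B * (sh ^S a) (2 ℕ.* m)) (ℕ.*-suc 2 j) ⟨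
    A * (sh ^S (2 ℕ.* j)) (2 ℕ.* m) + B * (sh ^S (2 ℕ.* suc j)) (2 ℕ.* m)
                                            ∎
    where
    open ≡-Reasoning
    A = (ι 2 + ι (2 ℕ.* j)) * (1ℚ + ι (2 ℕ.* j))
    B = ¼ * ((ι 2 + ι (2 ℕ.* j)) * (ι 2 + ι (2 ℕ.* j)))

  eulerSum : ℕ → ℕ → ℚ
  eulerSum k n = sumTo n (λ j → coeff k j * (sh ^S (2 ℕ.* j)) (2 ℕ.* n))

  eulerSum-suc : ∀ k n → eulerSum k (suc n) ≡ eulerSum (suc k) n
  eulerSum-suc k n = begin
    sumTo (suc n) term                               ≡⟨ sumTo-suc n term ⟩
    term 0 + sumTo n (term ∘ suc)                    ≡⟨ cong₂ _+_ (*-zeroʳ (coeff k 0)) (sumTo-cong n (λ j _ → split j)) ⟩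
    0ℚ + sumTo n (λ j → a j + φ (suc j))             ≡⟨ trans (+-identityˡ _) (sumTo-+ n a (φ ∘ suc)) ⟩
    sumTo n a + sumTo n (φ ∘ suc)                    ≡⟨ cong (sumTo n a +_) (sumTo-shift n φ φ0≡0 φ[1+n]≡0) ⟩
    sumTo n a + sumTo n φ                            ≡⟨ sumTo-+ n a φ ⟨
    sumTo n (λ j → a j + φ j)                        ≡⟨ sumTo-cong n (λ j _ → combine j) ⟩
    eulerSum (suc k) n                               ∎
    where
    open ≡-Reasoning
    term Q A φ a : ℕ → ℚ
    term j = coeff k j * (sh ^S (2 ℕ.* j)) (2 ℕ.* suc n)
    Q j = (sh ^S (2 ℕ.* j)) (2 ℕ.* n)
    A j = (ι 2 + ι (2 ℕ.* j)) * (1ℚ + ι (2 ℕ.* j))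
    φ j = coeff k j * ((ι j * ι j) * Q j)
    a j = coeff k (suc j) * (A j * Q j)
    ¼[2+2j]²≡[1+j]² : ∀ j → ¼ * ((ι 2 + ι (2 ℕ.* j)) * (ι 2 + ι (2 ℕ.* j))) ≡ ι (suc j) * ι (suc j)
    ¼[2+2j]²≡[1+j]² j = begin
      ¼ * ((ι 2 + ι (2 ℕ.* j)) * (ι 2 + ι (2 ℕ.* j)))    ≡⟨ cong (λ y → ¼ * ((ι 2 + y) * (ι 2 + y))) (ι-* 2 j) ⟩
      ¼ * ((ι 2 + ι 2 * ι j) * (ι 2 + ι 2 * ι j))        ≡⟨ lemma (ι j) ⟩
      (ι j + 1ℚ) * (ι j + 1ℚ)                            ≡⟨ cong (λ y → y * y) (ι-suc j) ⟨
      ι (suc j) * ι (suc j)                              ∎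
      where
      lemma : ∀ x → ¼ * ((ι 2 + ι 2 * x) * (ι 2 + ι 2 * x)) ≡ (x + 1ℚ) * (x + 1ℚ)
      lemma = solve-∀ ℚ-ring
    split : ∀ j → term (suc j) ≡ a j + φ (suc j)
    split j = begin
      coeff k (suc j) * (sh ^S (2 ℕ.* suc j)) (2 ℕ.* suc n)
        ≡⟨ cong (coeff k (suc j) *_) (sh^-even-recurrence j n) ⟩
      coeff k (suc j) * (A j * Q j + (¼ * ((ι 2 + ι (2 ℕ.* j)) * (ι 2 + ι (2 ℕ.* j)))) * Q (suc j))
        ≡⟨ *-distribˡ-+ (coeff k (suc j)) (A j * Q j) _ ⟩
      a j + coeff k (suc j) * ((¼ * ((ι 2 + ι (2 ℕ.* j)) * (ι 2 + ι (2 ℕ.* j)))) * Q (suc j))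
        ≡⟨ cong (λ y → a j + coeff k (suc j) * (y * Q (suc j))) (¼[2+2j]²≡[1+j]² j) ⟩
      a j + φ (suc j)
        ∎
    combine : ∀ j → a j + φ j ≡ coeff (suc k) j * Q j
    combine j = trans (lemma (coeff k (suc j)) (A j) (coeff k j) (ι j * ι j) (Q j)) (cong (_* Q j) (coeff-recurrence k j))
      where
      lemma : ∀ c₁ A c₀ B q → c₁ * (A * q) + c₀ * (B * q) ≡ (c₁ * A + c₀ * B) * q
      lemma = solve-∀ ℚ-ring
    φ0≡0 : φ 0 ≡ 0ℚ
    φ0≡0 = trans (cong (coeff k 0 *_) (*-zeroˡ (Q 0))) (*-zeroʳ (coeff k 0))
    φ[1+n]≡0 : φ (suc n) ≡ 0ℚ
    φ[1+n]≡0 = begin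
      coeff k (suc n) * ((ι (suc n) * ι (suc n)) * Q (suc n))   ≡⟨ cong (λ y → coeff k (suc n) * ((ι (suc n) * ι (suc n)) * y)) Q[1+n]≡0 ⟩
      coeff k (suc n) * ((ι (suc n) * ι (suc n)) * 0ℚ)          ≡⟨ trans (cong (coeff k (suc n) *_) (*-zeroʳ (ι (suc n) * ι (suc n)))) (*-zeroʳ (coeff k (suc n))) ⟩
      0ℚ                                                        ∎
      where
      Q[1+n]≡0 : Q (suc n) ≡ 0ℚ
      Q[1+n]≡0 = sh^-vanishesBelow (2 ℕ.* suc n) (2 ℕ.* n) (ℕ.*-monoʳ-< 2 (ℕ.n<1+n n))

  eulerSum-shift : ∀ k n → eulerSum k n ≡ eulerSum 0 (n ℕ.+ k)
  eulerSum-shift zero    n = cong (eulerSum 0) (sym (ℕ.+-identityʳ n))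
  eulerSum-shift (suc k) n = begin
    eulerSum (suc k) n          ≡⟨ eulerSum-suc k n ⟨
    eulerSum k (suc n)          ≡⟨ eulerSum-shift k (suc n) ⟩
    eulerSum 0 (suc n ℕ.+ k)    ≡⟨ cong (eulerSum 0) (ℕ.+-suc n k) ⟨
    eulerSum 0 (n ℕ.+ suc k)    ∎
    where open ≡-Reasoning

  eulerSum-0≡E : ∀ E → IsEuler E → ∀ n → eulerSum 0 n ≡ E (2 ℕ.* n)
  eulerSum-0≡E E isEuler n = begin
    sechApprox n (2 ℕ.* n)              ≡⟨ sechApprox-stable (ℕ.m≤n*m n 2) (ℕ.*-monoʳ-< 2 (ℕ.n<1+n n)) ⟨
    sechApprox (2 ℕ.* n) (2 ℕ.* n)      ≡⟨ euler≗sech E isEuler (2 ℕ.* n) ⟨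
    E (2 ℕ.* n)                         ∎
    where open ≡-Reasoning

  eulerSum-term : ∀ {T} → IsCentralFact2 T → ∀ k {n j} → j ≤ n →
    coeff k j * (sh ^S (2 ℕ.* j)) (2 ℕ.* n) ≡ (((- 1ℚ) ^ℚ (j ℕ.+ k) * ι ((2 ℕ.* j) !)) * Δ k (ι j)) * (½ ^ℚ j * T (2 ℕ.* n) (2 ℕ.* j))
  eulerSum-term {T} isCentralFact2 k {n} {j} j≤n = begin
    ((g * h) * Δ k (ι j)) * (sh ^S (2 ℕ.* j)) (2 ℕ.* n)
      ≡⟨ cong (((g * h) * Δ k (ι j)) *_) (isCentralFact2 (2 ℕ.* n) (2 ℕ.* j) (ℕ.*-monoʳ-≤ 2 j≤n)) ⟩
    ((g * h) * Δ k (ι j)) * (ι ((2 ℕ.* j) !) * T (2 ℕ.* n) (2 ℕ.* j))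
      ≡⟨ lemma g h (Δ k (ι j)) (ι ((2 ℕ.* j) !)) (T (2 ℕ.* n) (2 ℕ.* j)) ⟩
    ((g * ι ((2 ℕ.* j) !)) * Δ k (ι j)) * (h * T (2 ℕ.* n) (2 ℕ.* j))
      ∎
    where
    open ≡-Reasoning
    g = (- 1ℚ) ^ℚ (j ℕ.+ k)
    h = ½ ^ℚ j
    lemma : ∀ g h d f t → ((g * h) * d) * (f * t) ≡ ((g * f) * d) * (h * t)
    lemma = solve-∀ ℚ-ring

open EulerSeries using (sumTo-cong; eulerSum; eulerSum-0≡E; eulerSum-shift; eulerSum-term)
open import Data.Nat using (ℕ; _+_; _*_; _!)
open import Data.Nat.Properties using (*-distribˡ-+)
open import Data.Rational using (ℚ; -_; 1ℚ; ½)
import Data.Rational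
open import Relation.Binary.PropositionalEquality using (_≡_; cong; module ≡-Reasoning)

theorem5 : (E : ℕ → ℚ) → IsEuler E → (T : ℕ → ℕ → ℚ) → IsCentralFact2 T →
    ∀ (n k : ℕ) →
      E (2 * n + 2 * k)
        ≡ sumTo n (λ j → ((((- 1ℚ) ^ℚ (j + k)) Data.Rational.* ι ((2 * j) !)) Data.Rational.* Δ k (ι j)) Data.Rational.* ((½ ^ℚ j) Data.Rational.* T (2 * n) (2 * j)))
theorem5 E isEuler T isCentralFact2 n k = begin
  E (2 * n + 2 * k)      ≡⟨ cong E (*-distribˡ-+ 2 n k) ⟨
  E (2 * (n + k))        ≡⟨ eulerSum-0≡E E isEuler (n + k) ⟨
  eulerSum 0 (n + k)     ≡⟨ eulerSum-shift k n ⟨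
  eulerSum k n           ≡⟨ sumTo-cong n (λ j → eulerSum-term isCentralFact2 k) ⟩
  _                      ∎
  where open ≡-Reasoning
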